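{- Let $G$ be a connected graph, $r\ge2$ an integer, $H=G^r$, and $v\in V(G)$. Then the vertices of any $v$-rooted isometric path $Q$ of $G$ can be covered by $r$ many $v$-rooted isometric paths of $H$.
   Context: $G^r$ is the graph on $V(G)$ in which two distinct vertices are adjacent iff their distance in $G$ is at most $r$. An isometric path is a shortest path between its end-vertices (in the indicated graph); it is $v$-rooted if $v$ is one of its end-vertices. -}

module Defs where

open import Data.Nat using (ℕ; zero; suc; _≤_; _<_)
open import Data.Fin using (Fin)
open import Data.List using (List)
open import Data.List.NonEmpty using (List⁺; head; last; tail; toList)
open import Data.List.Relation.Unary.Linked using (Linked)
open import Data.Product using (Σ; ∃; _×_)
open import Data.Sum using (_⊎_)
open import Relation.Binary.PropositionalEquality using (_≡_; _≢_)
open import Relation.Nullary using (¬_)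
import Data.List as L

record Graph (n : ℕ) : Set₁ where
  field
    Adj   : Fin n → Fin n → Set
    sym   : ∀ {x y} → Adj x y → Adj y x
    irrefl : ∀ {x} → ¬ Adj x x
open Graph public

data Walk {n : ℕ} (G : Graph n) : Fin n → Fin n → ℕ → Set where
  []  : ∀ {x} → Walk G x x zero
  _∷_ : ∀ {x y z k} → Adj G x y → Walk G y z k → Walk G x z (suc k)

Connected : ∀ {n} → Graph n → Set
Connected G = ∀ x y → ∃ λ k → Walk G x y k

DistLe : ∀ {n} → Graph n → ℕ → Fin n → Fin n → Set
DistLe G r x y = ∃ λ k → k ≤ r × Walk G x y k

_^_ : ∀ {n} → Graph n → ℕ → Graph n
G ^ r = record
  { Adj = λ x y → x ≢ y × DistLe G r x y
  ; sym = λ { (x≢y , k , k≤r , w) → (λ e → x≢y (Relation.Binary.PropositionalEquality.sym e)) , k , k≤r , rev w }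
  ; irrefl = λ { (x≢x , _) → x≢x Relation.Binary.PropositionalEquality.refl }
  }
  where
  open import Data.Nat.Properties using (+-comm)
  open import Data.Product using (_,_)
  snoc : ∀ {x y z k} → Walk G x y k → Adj G y z → Walk G x z (suc k)
  snoc [] a = a ∷ []
  snoc (b ∷ w) a = b ∷ snoc w a
  rev : ∀ {x y k} → Walk G x y k → Walk G y x k
  rev [] = []
  rev (a ∷ w) = snoc (rev w) (Graph.sym G a)

-- A path given by its (nonempty) vertex sequence; its length is the number of edges.
IsometricPath : ∀ {n} → Graph n → List⁺ (Fin n) → Set
IsometricPath G P =
  Linked (Adj G) (toList P) ×
  (∀ k → k < L.length (tail P) → ¬ Walk G (head P) (last P) k)

Rooted : ∀ {n} → Fin n → List⁺ (Fin n) → Set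
Rooted v P = head P ≡ v ⊎ last P ≡ v

-- Number the vertices of Q as q₀ = v, q₁, …, q_L. For each a ∈ {1, …, r} the vertices
-- v, q_a, q_{a+r}, q_{a+2r}, … form a path of G^r: consecutive ones are distinct and at
-- G-distance at most r. It is isometric in G^r, because a G^r-walk with k steps yields a
-- G-walk of length at most k r, while its last vertex q_{a+tr} lies at G-distance
-- a + t r > t r from v since Q is a shortest path. Every q_j lies on one of these r paths.
module Submission where

open import Defs hiding (sym)
open import Data.Nat using (ℕ; zero; suc; _+_; _*_; _∸_; _≤_; _<_; z≤n; s≤s; s≤s⁻¹; NonZero; >-nonZero⁻¹; _≤?_)
open import Data.Nat.Properties
open import Data.Nat.DivMod using (_%_; _/_; m≡m%n+[m/n]*n; m%n<n)
open import Data.Fin using (Fin; toℕ; fromℕ<)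
open import Data.Fin.Properties using (toℕ<n; toℕ-fromℕ<)
open import Data.List as List using (List; []; _∷_; length; map; _∷ʳ′_)
open import Data.List.Properties using (length-map)
open import Data.List.NonEmpty using (List⁺; _∷_; head; last; tail; toList)
open import Data.List.Relation.Unary.Linked using (Linked; [-]; _∷_)
open import Data.List.Relation.Unary.Any using (here; there)
open import Data.List.Membership.Propositional using (_∈_)
open import Data.List.Membership.Propositional.Properties using (∈-map⁺)
open import Data.Product using (Σ; ∃; _×_; _,_)
open import Data.Sum using (_⊎_; inj₁; inj₂)
open import Relation.Nullary using (¬_; yes; no; contradiction)
open import Relation.Binary.PropositionalEquality
  using (_≡_; _≢_; refl; sym; trans; cong; subst; subst₂)

last-∷ : ∀ {A : Set} (x y : A) ys → last (x ∷ y ∷ ys) ≡ last (y ∷ ys)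
last-∷ x y ys with List.initLast ys
... | []      = refl
... | _ ∷ʳ′ _ = refl

-- Indexing clamped at the last vertex.
vertex : ∀ {A : Set} → List⁺ A → ℕ → A
vertex (x ∷ _)      zero    = x
vertex (x ∷ [])     (suc j) = x
vertex (x ∷ y ∷ ys) (suc j) = vertex (y ∷ ys) j

vertex-last : ∀ {A : Set} (x : A) xs → vertex (x ∷ xs) (length xs) ≡ last (x ∷ xs)
vertex-last x []       = refl
vertex-last x (y ∷ ys) = trans (vertex-last y ys) (sym (last-∷ x y ys))

∈⇒vertex : ∀ {A : Set} {u : A} (P : List⁺ A) → u ∈ toList P → ∃ λ j → j ≤ length (tail P) × u ≡ vertex P j
∈⇒vertex (x ∷ _)      (here u≡x) = 0 , z≤n , u≡x
∈⇒vertex (x ∷ y ∷ ys) (there u∈) with ∈⇒vertex (y ∷ ys) u∈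
... | j , j≤ , u≡ = suc j , s≤s j≤ , u≡

linked-vertex : ∀ {A : Set} {R : A → A → Set} (P : List⁺ A) → Linked R (toList P) →
  ∀ j → j < length (tail P) → R (vertex P j) (vertex P (suc j))
linked-vertex (x ∷ y ∷ ys) (Rxy ∷ _) zero    _         = Rxy
linked-vertex (x ∷ y ∷ ys) (_ ∷ lk)  (suc j) (s≤s j<) = linked-vertex (y ∷ ys) lk j j<

module _ {n} {G : Graph n} where

  infixr 5 _++ʷ_

  _++ʷ_ : ∀ {x y z k l} → Walk G x y k → Walk G y z l → Walk G x z (k + l)
  []      ++ʷ w = w
  (e ∷ u) ++ʷ w = e ∷ (u ++ʷ w)

  _∷ʳʷ_ : ∀ {x y z k} → Walk G x y k → Adj G y z → Walk G x z (suc k)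
  []      ∷ʳʷ e = e ∷ []
  (d ∷ w) ∷ʳʷ e = d ∷ (w ∷ʳʷ e)

  reverseʷ : ∀ {x y k} → Walk G x y k → Walk G y x k
  reverseʷ []      = []
  reverseʷ (e ∷ w) = reverseʷ w ∷ʳʷ Graph.sym G e

  power-walk⇒walk : ∀ {r x y k} → Walk (G ^ r) x y k → ∃ λ l → l ≤ k * r × Walk G x y l
  power-walk⇒walk [] = 0 , z≤n , []
  power-walk⇒walk ((_ , l , l≤r , w) ∷ ws) with power-walk⇒walk ws
  ... | m , m≤ , w′ = l + m , +-mono-≤ l≤r m≤ , w ++ʷ w′

record Geodesic {n} (G : Graph n) (f : ℕ → Fin n) (L : ℕ) : Set where
  field
    step     : ∀ j → j < L → Adj G (f j) (f (suc j))
    shortest : ∀ k → k < L → ¬ Walk G (f 0) (f L) k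

reverse-geodesic : ∀ {n} {G : Graph n} {f L} → Geodesic G f L → Geodesic G (λ j → f (L ∸ j)) L
reverse-geodesic {G = G} {f} {L} geo = record { step = step′ ; shortest = shortest′ }
  where
  open Geodesic geo
  suc[L∸suc[j]]≡L∸j : ∀ {j} → j < L → suc (L ∸ suc j) ≡ L ∸ j
  suc[L∸suc[j]]≡L∸j {j} (s≤s j≤L-1) = sym (+-∸-assoc 1 j≤L-1)

  step′ : ∀ j → j < L → Adj G (f (L ∸ j)) (f (L ∸ suc j))
  step′ j j<L = Graph.sym G (subst (λ i → Adj G (f (L ∸ suc j)) (f i)) (suc[L∸suc[j]]≡L∸j j<L)
    (step (L ∸ suc j) (subst (_≤ L) (sym (suc[L∸suc[j]]≡L∸j j<L)) (m∸n≤m L j))))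

  shortest′ : ∀ k → k < L → ¬ Walk G (f L) (f (L ∸ L)) k
  shortest′ k k<L w = shortest k k<L (subst (λ x → Walk G x (f L) k) (cong f (n∸n≡0 L)) (reverseʷ w))

module GeodesicProperties {n} {G : Graph n} {f L} (geo : Geodesic G f L) where
  open Geodesic geo

  segment : ∀ b d → b + d ≤ L → Walk G (f b) (f (b + d)) d
  segment b zero    _  rewrite +-identityʳ b = []
  segment b (suc d) le rewrite +-suc b d     =
    step b (≤-trans (s≤s (m≤m+n b d)) le) ∷ segment (suc b) d le

  prefix-shortest : ∀ j → j ≤ L → ∀ k → k < j → ¬ Walk G (f 0) (f j) k
  prefix-shortest j j≤L k k<j w =
    shortest (k + (L ∸ j)) (subst (k + (L ∸ j) <_) j+[L∸j]≡L (+-monoˡ-< (L ∸ j) k<j))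
      (subst (λ i → Walk G (f 0) (f i) (k + (L ∸ j))) j+[L∸j]≡L
        (w ++ʷ segment j (L ∸ j) (≤-reflexive j+[L∸j]≡L)))
    where
    j+[L∸j]≡L : j + (L ∸ j) ≡ L
    j+[L∸j]≡L = m+[n∸m]≡n j≤L

  distinct : ∀ b d → 0 < d → b + d ≤ L → f b ≢ f (b + d)
  distinct b d 0<d le eq =
    prefix-shortest (b + d) le b (m<m+n b 0<d)
      (subst (λ x → Walk G (f 0) x b) eq (segment 0 b (≤-trans (m≤m+n b d) le)))

  power-adj : ∀ {r} b d → 0 < d → d ≤ r → b + d ≤ L → Adj (G ^ r) (f b) (f (b + d))
  power-adj b d 0<d d≤r le = distinct b d 0<d le , d , d≤r , segment b d le

module StridePaths {n} {G : Graph n} {f L} (geo : Geodesic G f L) (r : ℕ) .{{_ : NonZero r}} where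
  open GeodesicProperties geo

  -- The indices a, a + r, a + 2r, … that are at most L; fuel suc L is always enough.
  stride : ℕ → ℕ → List ℕ
  stride zero       a = []
  stride (suc fuel) a with a ≤? L
  ... | yes _ = a ∷ stride fuel (a + r)
  ... | no  _ = []

  stride-linked : ∀ fuel b d → 0 < d → d ≤ r → Linked (Adj (G ^ r)) (f b ∷ map f (stride fuel (b + d)))
  stride-linked zero       b d _   _   = [-]
  stride-linked (suc fuel) b d 0<d d≤r with b + d ≤? L
  ... | yes le = power-adj b d 0<d d≤r le ∷ stride-linked fuel (b + d) r (>-nonZero⁻¹ r) ≤-refl
  ... | no  _  = [-]

  stride-∈ : ∀ fuel a t → t < fuel → a + t * r ≤ L → a + t * r ∈ stride fuel a
  stride-∈ (suc fuel) a t t<fuel le with a ≤? L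
  ... | no a≰L = contradiction (≤-trans (m≤m+n a (t * r)) le) a≰L
  stride-∈ (suc fuel) a zero    _           _  | yes _ = here (+-identityʳ a)
  stride-∈ (suc fuel) a (suc t) (s≤s t<fuel) le | yes _ =
    there (subst (_∈ stride fuel (a + r)) (+-assoc a r (t * r))
      (stride-∈ fuel (a + r) t t<fuel (subst (_≤ L) (sym (+-assoc a r (t * r))) le)))

  stride-last : ∀ fuel a x → stride fuel a ≡ [] ⊎
    (∃ λ t → length (stride fuel a) ≡ suc t × last (x ∷ map f (stride fuel a)) ≡ f (a + t * r) × a + t * r ≤ L)
  stride-last zero       a x = inj₁ refl
  stride-last (suc fuel) a x with a ≤? L
  ... | no  _   = inj₁ refl
  ... | yes a≤L with stride fuel (a + r) | stride-last fuel (a + r) (f a)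
  ...   | []     | _ = inj₂ (0 , refl , cong f (sym (+-identityʳ a)) , subst (_≤ L) (sym (+-identityʳ a)) a≤L)
  ...   | i ∷ is | inj₂ (t , len , lst , le) =
    inj₂ (suc t , cong suc len ,
          trans (last-∷ x (f a) (map f (i ∷ is))) (trans lst (cong f (+-assoc a r (t * r)))) ,
          subst (_≤ L) (+-assoc a r (t * r)) le)

  stride-path : ℕ → List⁺ (Fin n)
  stride-path a = f 0 ∷ map f (stride (suc L) a)

  stride-path-isometric : ∀ a → 0 < a → a ≤ r → IsometricPath (G ^ r) (stride-path a)
  stride-path-isometric a 0<a a≤r = stride-linked (suc L) 0 a 0<a a≤r , no-shorter
    where
    no-shorter : ∀ k → k < length (map f (stride (suc L) a)) → ¬ Walk (G ^ r) (f 0) (last (stride-path a)) k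
    no-shorter k k<len w with stride (suc L) a | stride-last (suc L) a (f 0)
    ... | [] | _ = contradiction k<len λ ()
    ... | i ∷ is | inj₂ (t , len , lst , le) with power-walk⇒walk (subst (λ x → Walk (G ^ r) (f 0) x k) lst w)
    ...   | l , l≤kr , w′ = prefix-shortest (a + t * r) le l l<a+tr w′
      where
      k≤t : k ≤ t
      k≤t = s≤s⁻¹ (subst (k <_) (trans (length-map f (i ∷ is)) len) k<len)
      l<a+tr : l < a + t * r
      l<a+tr = ≤-<-trans l≤kr (≤-<-trans (*-monoˡ-≤ r k≤t) (m<n+m (t * r) 0<a))

  stride-path-covers : ∀ j → j ≤ L → ∃ λ (i : Fin r) → f j ∈ toList (stride-path (suc (toℕ i)))
  stride-path-covers zero    _   = fromℕ< (>-nonZero⁻¹ r) , here refl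
  stride-path-covers (suc j) suc[j]≤L =
    i , there (∈-map⁺ f (subst₂ _∈_ (sym suc[j]≡) stride≡ (stride-∈ (suc L) (suc s) t t<fuel le)))
    where
    s = j % r
    t = j / r
    i = fromℕ< (m%n<n j r)
    suc[j]≡ : suc j ≡ suc s + t * r
    suc[j]≡ = cong suc (m≡m%n+[m/n]*n j r)
    le : suc s + t * r ≤ L
    le = subst (_≤ L) suc[j]≡ suc[j]≤L
    t<fuel : t < suc L
    t<fuel = s≤s (≤-trans (m≤m*n t r) (≤-trans (m≤n+m (t * r) (suc s)) le))
    stride≡ : stride (suc L) (suc s) ≡ stride (suc L) (suc (toℕ i))
    stride≡ = cong (λ a → stride (suc L) (suc a)) (sym (toℕ-fromℕ< (m%n<n j r)))

geodesic-covered-by-power-geodesics : ∀ {n} {G : Graph n} {f L} → Geodesic G f L → (r : ℕ) .{{_ : NonZero r}} →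
  Σ (Fin r → List⁺ (Fin n)) λ Ps →
    (∀ i → IsometricPath (G ^ r) (Ps i) × head (Ps i) ≡ f 0) ×
    (∀ j → j ≤ L → ∃ λ i → f j ∈ toList (Ps i))
geodesic-covered-by-power-geodesics geo r =
  (λ i → stride-path (suc (toℕ i))) ,
  (λ i → stride-path-isometric (suc (toℕ i)) (s≤s z≤n) (toℕ<n i) , refl) ,
  stride-path-covers
  where open StridePaths geo r

isometric⇒geodesic : ∀ {n} {G : Graph n} {P} → IsometricPath G P → Geodesic G (vertex P) (length (tail P))
isometric⇒geodesic {G = G} {P = x ∷ xs} (linked , shortest) = record
  { step     = linked-vertex (x ∷ xs) linked
  ; shortest = λ k k< w → shortest k k< (subst (λ y → Walk G x y k) (vertex-last x xs) w)
  }

rooted-geodesic : ∀ {n} {G : Graph n} {v Q} → IsometricPath G Q → Rooted v Q →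
  ∃ λ f → Geodesic G f (length (tail Q)) × f 0 ≡ v ×
    (∀ u → u ∈ toList Q → ∃ λ j → j ≤ length (tail Q) × u ≡ f j)
rooted-geodesic {Q = x ∷ xs} iso (inj₁ head≡v) =
  vertex (x ∷ xs) , isometric⇒geodesic iso , head≡v , λ _ → ∈⇒vertex (x ∷ xs)
rooted-geodesic {Q = x ∷ xs} iso (inj₂ last≡v) =
  (λ j → vertex (x ∷ xs) (L ∸ j)) , reverse-geodesic (isometric⇒geodesic iso) ,
  trans (vertex-last x xs) last≡v , reindex
  where
  L = length xs
  reindex : ∀ u → u ∈ toList (x ∷ xs) → ∃ λ j → j ≤ L × u ≡ vertex (x ∷ xs) (L ∸ j)
  reindex u u∈ with ∈⇒vertex (x ∷ xs) u∈
  ... | j , j≤L , u≡ = L ∸ j , m∸n≤m L j , trans u≡ (cong (vertex (x ∷ xs)) (sym (m∸[m∸n]≡n j≤L)))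

lemma4p2 : ∀ {n} (G : Graph n) → Connected G → (r : ℕ) → 2 ≤ r → (v : Fin n) →
    (Q : List⁺ (Fin n)) → IsometricPath G Q → Rooted v Q →
    Σ (Fin r → List⁺ (Fin n)) λ Ps →
      (∀ i → IsometricPath (G ^ r) (Ps i) × Rooted v (Ps i)) ×
      (∀ u → u ∈ toList Q → ∃ λ i → u ∈ toList (Ps i))
lemma4p2 G _ r@(suc _) (s≤s _) v Q iso rooted =
  let f , geo , f0≡v , Q⊆f = rooted-geodesic iso rooted
      Ps , Ps-isometric , covers = geodesic-covered-by-power-geodesics geo r
  in Ps ,
     (λ i → let iso-i , head≡f0 = Ps-isometric i in iso-i , inj₁ (trans head≡f0 f0≡v)) ,
     (λ u u∈Q → let j , j≤L , u≡fj = Q⊆f u u∈Q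
                in subst (λ w → ∃ λ i → w ∈ toList (Ps i)) (sym u≡fj) (covers j j≤L))
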